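{- Let $T$ be any tree. Let $S$ be a spanning tree that is strongly stable on a set of vertices $\mathbb{O}$ and is a skeleton of $T$ (with respect to $\mathbb{O}$). Let $\mathcal{O}=V\setminus V(T)$. Then, for any spanning tree $T'$ with $T\subseteq T'$, the tree $T'$ is strongly stable on $\mathbb{O}\setminus\mathcal{O}$.
   Context: $G=(V,A_G)$ is a directed graph with sink $r$; each node $v\neq r$ has a strict ranking of its out-neighbours. A tree is an in-arborescence in $G$ rooted at $r$; a spanning tree is one containing all nodes; for $(v,w)$ in a tree, $w$ is the parent of $v$. For $Q\subseteq V$ and $v\in Q$, the $Q$-subtree of $v$ with respect to a tree $S$ is the maximal subtree rooted at $v$ of the forest $S[Q]$ (subgraph of $S$ induced by $Q$). $S$ is strongly stable on $\mathbb{O}$ if every node $v\in\mathbb{O}$ with $(v,w)\in S$ prefers its parent $w$ to every other out-neighbour of $v$ outside the $\mathbb{O}$-subtree of $v$. For a set of nodes $U$, $\mathcal{A}^+_S(U)=\{(u,v)\in S: u\in U\}$. A spanning tree $S$ is a skeleton of a tree $T$ (with respect to $\mathbb{O}$) if for every maximal subtree $F$ of the forest $S[\mathbb{O}]$, either $T$ contains $\mathcal{A}^+_S(V(F))$ or $T$ contains no node of $F$. -}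

module Defs where

open import Data.Nat using (ℕ; _<_)
open import Data.Fin using (Fin)
open import Data.Product using (Σ; ∃; _×_; _,_)
open import Data.Sum using (_⊎_)
open import Relation.Nullary using (¬_)
open import Relation.Binary.PropositionalEquality using (_≡_)
open import Relation.Binary.Construct.Closure.ReflexiveTransitive using (Star)

-- A directed graph on the node set Fin n with sink r; every node v ≠ r
-- has a strict ranking of its out-neighbours, given by rank v : lower
-- rank = more preferred, injective on the out-neighbours of v.
record Graph (n : ℕ) : Set₁ where
  field
    r     : Fin n
    Arc   : Fin n → Fin n → Set
    sink  : ∀ w → ¬ Arc r w
    rank  : Fin n → Fin n → ℕ
    rank-strict : ∀ v u w → ¬ v ≡ r → Arc v u → Arc v w → rank v u ≡ rank v w → u ≡ w

NodeSet : ℕ → Set₁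
NodeSet n = Fin n → Set

ArcSet : ℕ → Set₁
ArcSet n = Fin n → Fin n → Set

module _ {n : ℕ} (G : Graph n) where
  open Graph G

  Prefers : Fin n → Fin n → Fin n → Set
  Prefers v w u = rank v w < rank v u

  -- node set V(S) of an arc set S (the root r always belongs to a tree)
  Nodes : ArcSet n → NodeSet n
  Nodes S v = v ≡ r ⊎ (∃ λ w → S v w) ⊎ (∃ λ u → S u v)

  -- S is a tree: an in-arborescence in G rooted at r
  record IsTree (S : ArcSet n) : Set where
    field
      arcs⊆G   : ∀ u w → S u w → Arc u w
      root-out : ∀ w → ¬ S r w
      parent   : ∀ v → Nodes S v → ¬ v ≡ r → ∃ λ w → S v w
      parent-unique : ∀ v w w′ → S v w → S v w′ → w ≡ w′
      reaches-root  : ∀ v → Nodes S v → Star S v r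

  IsSpanningTree : ArcSet n → Set
  IsSpanningTree S = IsTree S × (∀ v → Nodes S v)

  Induced : ArcSet n → NodeSet n → ArcSet n
  Induced S Q u w = S u w × Q u × Q w

  Subtree : ArcSet n → NodeSet n → Fin n → NodeSet n
  Subtree S Q v u = Star (Induced S Q) u v

  StronglyStable : ArcSet n → NodeSet n → Set
  StronglyStable S O = ∀ v w → O v → S v w →
    ∀ u → Arc v u → ¬ u ≡ w → ¬ Subtree S O v u → Prefers v w u

  -- roots of maximal subtrees of the forest S[O]: nodes of O whose
  -- S-parent (if any) lies outside O; the maximal subtree is then
  -- the O-subtree of such a root
  MaxRoot : ArcSet n → NodeSet n → Fin n → Set
  MaxRoot S O ρ = O ρ × (∀ w → S ρ w → ¬ O w)

  OutArcsIn : ArcSet n → NodeSet n → ArcSet n → Set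
  OutArcsIn S U T = ∀ u w → U u → S u w → T u w

  IsSkeleton : ArcSet n → NodeSet n → ArcSet n → Set
  IsSkeleton S O T = IsSpanningTree S × (∀ ρ → MaxRoot S O ρ →
    OutArcsIn S (Subtree S O ρ) T ⊎ (∀ u → Subtree S O ρ u → ¬ Nodes T u))

-- Fix v ∈ 𝕆 ∩ V(T) with T′-parent w and another out-neighbour u outside the
-- (𝕆 ∖ 𝒪)-subtree of v in T′.  The node v lies in a maximal subtree F of S[𝕆];
-- since v ∈ V(T), the skeleton property puts all S-arcs leaving F into T ⊆ T′.
-- Hence the S-parent of v is also its T′-parent w, and every S[𝕆]-path into v
-- is a T′-path inside 𝕆 ∩ V(T).  So u is outside the 𝕆-subtree of v in S, and
-- strong stability of S on 𝕆 gives that v prefers w to u.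
module Submission where

open import Defs
open import Data.Nat using (ℕ; _<?_)
open import Data.Fin using (Fin)
open import Data.Product using (_×_; _,_; ∃)
open import Data.Sum using (_⊎_; inj₁; inj₂)
open import Relation.Nullary using (¬_; yes; no)
open import Relation.Nullary.Decidable using (decidable-stable; ¬¬-excluded-middle)
open import Relation.Binary.PropositionalEquality using (refl; subst)
open import Relation.Binary.Construct.Closure.ReflexiveTransitive
  using (Star; ε; _◅_; _◅◅_; map)

module _ {n : ℕ} (G : Graph n) where
  open Graph G

  Induced-mono : ∀ {S S′ : ArcSet n} {Q : NodeSet n} →
    (∀ u w → S u w → S′ u w) → ∀ {u w} → Induced G S Q u w → Induced G S′ Q u w
  Induced-mono S⊆S′ (Suw , Qu , Qw) = S⊆S′ _ _ Suw , Qu , Qw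

  -- Membership in O is not decidable, so walking up from x to the first
  -- ancestor whose parent leaves O only succeeds under double negation.
  ¬¬-maxRoot-above : ∀ {S : ArcSet n} {O : NodeSet n} → IsTree G S →
    ∀ x → Star S x r → O x →
    ¬ ¬ (∃ λ ρ → MaxRoot G S O ρ × Subtree G S O ρ x)
  ¬¬-maxRoot-above tS x ε Ox k =
    k (x , (Ox , λ w Srw _ → IsTree.root-out tS w Srw) , ε)
  ¬¬-maxRoot-above {S} {O} tS x (_◅_ {j = y} Sxy y↝r) Ox k = ¬¬-excluded-middle λ
    { (yes Oy) → ¬¬-maxRoot-above tS y y↝r Oy λ
        { (ρ , maxρ , y∈ρ) → k (ρ , maxρ , (Sxy , Ox , Oy) ◅ y∈ρ) }
    ; (no ¬Oy) → k (x , (Ox , exits ¬Oy) , ε) }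
    where
    exits : ¬ O y → ∀ w → S x w → ¬ O w
    exits ¬Oy w Sxw Ow = ¬Oy (subst O (IsTree.parent-unique tS x w y Sxw Sxy) Ow)

  module _ {S T : ArcSet n} {O : NodeSet n} {ρ : Fin n}
           (covered : OutArcsIn G S (Subtree G S O ρ) T) where

    covered-path : ∀ {z v} → Star (Induced G S O) z v → Subtree G S O ρ v →
      Star (Induced G T (λ x → O x × Nodes G T x)) z v
    covered-path ε _ = ε
    covered-path {z} (_◅_ {j = z′} S[O]zz′@(Szz′ , Oz , Oz′) z′↝v) v∈ρ =
      (Tzz′ , (Oz , inj₂ (inj₁ (z′ , Tzz′))) , (Oz′ , inj₂ (inj₂ (z , Tzz′))))
        ◅ covered-path z′↝v v∈ρ
      where
      Tzz′ : T z z′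
      Tzz′ = covered z z′ (S[O]zz′ ◅ (z′↝v ◅◅ v∈ρ)) Szz′

    covered-parent : ∀ {T′ : ArcSet n} → IsSpanningTree G S → IsTree G T′ →
      (∀ u w → T u w → T′ u w) →
      ∀ {v w} → Subtree G S O ρ v → T′ v w → S v w
    covered-parent (tS , spS) tT′ T⊆T′ {v} {w} v∈ρ T′vw
      with IsTree.parent tS v (spS v) (λ { refl → IsTree.root-out tT′ w T′vw })
    ... | s , Svs
      with IsTree.parent-unique tT′ v w s T′vw (T⊆T′ v s (covered v s v∈ρ Svs))
    ... | refl = Svs

lemma5 : ∀ {n : ℕ} (G : Graph n) (O : NodeSet n) (T S : ArcSet n) →
    IsTree G T →
    IsSpanningTree G S → StronglyStable G S O → IsSkeleton G S O T →
    ∀ (T′ : ArcSet n) → IsSpanningTree G T′ → (∀ u w → T u w → T′ u w) →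
    StronglyStable G T′ (λ v → O v × Nodes G T v)
lemma5 G O T S _ spanS@(tS , spS) stableS (_ , skeleton) T′ (tT′ , _) T⊆T′
       v w (Ov , v∈T) T′vw u Avu u≢w u∉subtree =
  decidable-stable (_ <? _) λ v⊁u →
    ¬¬-maxRoot-above G tS v (IsTree.reaches-root tS v (spS v)) Ov λ
      { (ρ , maxρ , v∈ρ) → case-skeleton ρ v∈ρ (skeleton ρ maxρ) v⊁u }
  where
  case-skeleton : ∀ ρ → Subtree G S O ρ v →
    OutArcsIn G S (Subtree G S O ρ) T ⊎ (∀ x → Subtree G S O ρ x → ¬ Nodes G T x) →
    ¬ ¬ Prefers G v w u
  case-skeleton ρ v∈ρ (inj₂ disjoint) _ = disjoint v v∈ρ v∈T
  case-skeleton ρ v∈ρ (inj₁ covered) v⊁u =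
    v⊁u (stableS v w Ov (covered-parent G covered spanS tT′ T⊆T′ v∈ρ T′vw)
                 u Avu u≢w
                 λ u∈subtree → u∉subtree (map (Induced-mono G T⊆T′)
                                              (covered-path G covered u∈subtree v∈ρ)))
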